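{- Let $G$ be a connected $P_5$-free chordal bipartite graph that has no Hamiltonian path. Then $G$ is not path-hypohamiltonian.
   Context: Graphs are finite, simple and undirected. A bipartite graph is chordal bipartite if every cycle of length at least six has a chord. $P_5$-free means no induced path on five vertices. A graph $G$ is path-hypohamiltonian if $G$ has no Hamiltonian path and for every vertex $v\in V(G)$ the graph $G-v$ has a Hamiltonian path. -}

module Defs where

open import Data.Bool using (Bool; true; false; T)
open import Data.Nat using (ℕ; zero; suc; _≤_)
open import Data.Fin using (Fin; toℕ; punchIn)
open import Data.List using (List; []; _∷_; length)
open import Data.List.Membership.Propositional using (_∈_)
open import Data.List.Relation.Unary.Unique.Propositional using (Unique)
open import Data.List.Relation.Unary.Linked using (Linked)
open import Data.Product using (Σ; ∃; ∃-syntax; _×_; _,_)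
open import Data.Sum using (_⊎_)
open import Data.Unit using (⊤)
open import Relation.Nullary using (¬_)
open import Relation.Binary.PropositionalEquality using (_≡_; _≢_)
open import Function.Definitions using (Injective)

record Graph (n : ℕ) : Set where
  field
    adj   : Fin n → Fin n → Bool
    sym   : ∀ u v → adj u v ≡ adj v u
    irref : ∀ v → adj v v ≡ false

open Graph public

Edge : ∀ {n} → Graph n → Fin n → Fin n → Set
Edge G u v = T (adj G u v)

delete : ∀ {n} → Graph (suc n) → Fin (suc n) → Graph n
delete G v = record
  { adj   = λ i j → adj G (punchIn v i) (punchIn v j)
  ; sym   = λ i j → sym G (punchIn v i) (punchIn v j)
  ; irref = λ i → irref G (punchIn v i)
  }

data Walk {n} (G : Graph n) : Fin n → Fin n → Set where
  here : ∀ {u} → Walk G u u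
  step : ∀ {u w v} → Edge G u w → Walk G w v → Walk G u v

Connected : ∀ {n} → Graph n → Set
Connected G = ∀ u v → Walk G u v

record HamPath {n} (G : Graph n) : Set where
  field
    vertices : List (Fin n)
    distinct : Unique vertices
    covers   : ∀ v → v ∈ vertices
    linked   : Linked (Edge G) vertices

HasHamPath : ∀ {n} → Graph n → Set
HasHamPath G = HamPath G

PathHypohamiltonian : ∀ {n} → Graph n → Set
-- (For n = 0 there are no vertices, so the second clause is vacuous.)
PathHypohamiltonian {zero}  G = ¬ HasHamPath G × ⊤
PathHypohamiltonian {suc n} G = ¬ HasHamPath G × (∀ v → HasHamPath (delete G v))

Bipartite : ∀ {n} → Graph n → Set
Bipartite {n} G = Σ (Fin n → Bool) λ c → ∀ u v → Edge G u v → c u ≢ c v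

CycNext : ∀ {k} → Fin k → Fin k → Set
CycNext {k} i j = (suc (toℕ i) ≡ toℕ j) ⊎ (suc (toℕ i) ≡ k × toℕ j ≡ 0)

record Cycle {n} (G : Graph n) (k : ℕ) : Set where
  field
    pos   : Fin k → Fin n
    inj   : Injective _≡_ _≡_ pos
    edges : ∀ i j → CycNext i j → Edge G (pos i) (pos j)
    len   : 3 ≤ k

HasChord : ∀ {n} {G : Graph n} {k} → Cycle G k → Set
HasChord {G = G} {k} C =
  ∃[ i ] ∃[ j ] (Edge G (Cycle.pos C i) (Cycle.pos C j) × ¬ CycNext i j × ¬ CycNext j i)

ChordalBipartite : ∀ {n} → Graph n → Set
ChordalBipartite G = Bipartite G × (∀ k → 6 ≤ k → (C : Cycle G k) → HasChord C)

PathAdj : Fin 5 → Fin 5 → Set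
PathAdj i j = (suc (toℕ i) ≡ toℕ j) ⊎ (suc (toℕ j) ≡ toℕ i)

record InducedP5 {n} (G : Graph n) : Set where
  field
    f    : Fin 5 → Fin n
    inj  : Injective _≡_ _≡_ f
    fwd  : ∀ i j → Edge G (f i) (f j) → PathAdj i j
    bwd  : ∀ i j → PathAdj i j → Edge G (f i) (f j)

P5Free : ∀ {n} → Graph n → Set
P5Free G = ¬ InducedP5 G

-- Let x be a vertex of maximum degree.  Every path x ~ y ~ z ~ w has x ~ w: otherwise
-- deg z ≤ deg x yields a neighbour u of x not adjacent to z, and u x y z w is an induced P5.
-- By connectivity every vertex is then within distance two of x, so x is adjacent to the
-- whole colour class B opposite to its own class A.  A Hamiltonian path of G - x can thus
-- neither start nor end in B, since x could be attached there; both its ends lie in A and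
-- |A| = |B| + 2.  But a Hamiltonian path of G - y with y ∈ B alternates between the
-- classes, so |A| ≤ (|B| - 1) + 1.
module Submission where

open import Defs hiding (sym)
open import Data.Bool using (Bool; T)
open import Data.Bool.Properties using (_≟_; ¬-not; T?)
open import Data.Empty using (⊥; ⊥-elim)
open import Data.Fin using (Fin; toℕ; punchIn)
import Data.Fin as Fin
open import Data.Fin.Patterns using (0F; 1F; 2F; 3F; 4F)
open import Data.Fin.Properties using (punchIn-injective; punchInᵢ≢i; punchIn-punchOut; ¬∀⟶∃¬)
open import Data.List using (List; []; _∷_; _∷ʳ_; length; filter; map; allFin)
open import Data.List.Extrema.Nat using (argmax; f[xs]≤f[argmax])
open import Data.List.Properties using (filter-accept; filter-reject)
open import Data.List.Membership.Propositional using (_∈_)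
open import Data.List.Membership.Propositional.Properties using (∈-allFin; ∈-map⁺)
open import Data.List.Membership.Propositional.Properties.WithK using (unique∧set⇒bag)
open import Data.List.Relation.Binary.BagAndSetEquality using (∼bag⇒↭)
open import Data.List.Relation.Binary.Permutation.Propositional using (_↭_)
open import Data.List.Relation.Binary.Permutation.Propositional.Properties using (↭-length; filter-↭; ∈-resp-↭; ∷↭∷ʳ)
open import Data.List.Relation.Unary.All as All using ([]; _∷_)
import Data.List.Relation.Unary.All.Properties as All
open import Data.List.Relation.Unary.AllPairs as AllPairs using ([]; _∷_)
open import Data.List.Relation.Unary.Any using (here; there)
open import Data.List.Relation.Unary.Linked as Linked using (Linked; []; [-]; _∷_)
import Data.List.Relation.Unary.Linked.Properties as Linked
open import Data.List.Relation.Unary.Unique.Propositional using (Unique)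
import Data.List.Relation.Unary.Unique.Propositional.Properties as Unique
open import Data.Nat using (ℕ; zero; suc; _+_; _≤_; _<_; z≤n; s≤s)
open import Data.Nat.Properties using (≤-reflexive; ≤-trans; m≤n⇒m≤1+n; n≤1+n; <⇒≱; m+n≮n; module ≤-Reasoning)
open import Data.Product using (∃; _×_; _,_; proj₁; proj₂)
open import Data.Sum using (_⊎_; inj₁; inj₂)
open import Data.Vec using (Vec; _∷_; []; lookup)
open import Data.Vec.Relation.Unary.All using ([]; _∷_)
open import Data.Vec.Relation.Unary.AllPairs using ([]; _∷_)
open import Data.Vec.Relation.Unary.Unique.Propositional using () renaming (Unique to UniqueVec)
import Data.Vec.Relation.Unary.Unique.Propositional.Properties as Vec
open import Function using (_∘_)
open import Function.Bundles using (mk⇔)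
open import Level using (0ℓ)
open import Relation.Binary using (Rel)
open import Relation.Binary.PropositionalEquality using (_≡_; _≢_; refl; sym; trans; cong; subst; ≢-sym; module ≡-Reasoning)
open import Relation.Nullary using (¬_; Dec; yes; no; contradiction)
open import Relation.Nullary.Decidable using (decidable-stable; _→-dec_)
open import Relation.Unary using (Pred; Decidable; _⊆_)

count : {A : Set} {P : Pred A 0ℓ} → Decidable P → List A → ℕ
count P? xs = length (filter P? xs)

module _ {A : Set} {P : Pred A 0ℓ} (P? : Decidable P) where

  count-accept : ∀ {x xs} → P x → count P? (x ∷ xs) ≡ suc (count P? xs)
  count-accept px = cong length (filter-accept P? px)

  count-reject : ∀ {x xs} → ¬ P x → count P? (x ∷ xs) ≡ count P? xs
  count-reject ¬px = cong length (filter-reject P? ¬px)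

  count-↭ : ∀ {xs ys} → xs ↭ ys → count P? xs ≡ count P? ys
  count-↭ xs↭ys = ↭-length (filter-↭ P? xs↭ys)

module _ {A : Set} {P Q : Pred A 0ℓ} (P? : Decidable P) (Q? : Decidable Q) (P⊆Q : P ⊆ Q) where

  count-mono : ∀ xs → count P? xs ≤ count Q? xs
  count-mono [] = z≤n
  count-mono (x ∷ xs) with P? x | Q? x
  ... | yes _ | yes _ = s≤s (count-mono xs)
  ... | yes p | no ¬q = contradiction (P⊆Q p) ¬q
  ... | no _  | yes _ = m≤n⇒m≤1+n (count-mono xs)
  ... | no _  | no _  = count-mono xs

  count-mono-< : ∀ {y xs} → y ∈ xs → Q y → ¬ P y → count P? xs < count Q? xs
  count-mono-< {xs = x ∷ xs} (here refl) qy ¬py with P? x | Q? x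
  ... | yes py | _     = contradiction py ¬py
  ... | no _   | yes _ = s≤s (count-mono xs)
  ... | no _   | no ¬q = contradiction qy ¬q
  count-mono-< {xs = x ∷ xs} (there y∈xs) qy ¬py with P? x | Q? x
  ... | yes _ | yes _ = s≤s (count-mono-< y∈xs qy ¬py)
  ... | yes p | no ¬q = contradiction (P⊆Q p) ¬q
  ... | no _  | yes _ = m≤n⇒m≤1+n (count-mono-< y∈xs qy ¬py)
  ... | no _  | no _  = count-mono-< y∈xs qy ¬py

unique∧covering⇒↭ : {A : Set} {xs ys : List A} → Unique xs → Unique ys →
                    (∀ v → v ∈ xs) → (∀ v → v ∈ ys) → xs ↭ ys
unique∧covering⇒↭ xs! ys! xs-all ys-all =
  ∼bag⇒↭ (unique∧set⇒bag xs! ys! (mk⇔ (λ _ → ys-all _) (λ _ → xs-all _)))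

lastOf : {A : Set} → A → List A → A
lastOf x []       = x
lastOf _ (y ∷ ys) = lastOf y ys

Linked-∷ʳ : {A : Set} {R : Rel A 0ℓ} {x y : A} (xs : List A) →
            Linked R (x ∷ xs) → R (lastOf x xs) y → Linked R (x ∷ xs ∷ʳ y)
Linked-∷ʳ []       [-]      r = r ∷ [-]
Linked-∷ʳ (_ ∷ xs) (r′ ∷ rs) r = r′ ∷ Linked-∷ʳ xs rs r

Unique-∷ʳ : {A : Set} {x : A} {xs : List A} → Unique (x ∷ xs) → Unique (xs ∷ʳ x)
Unique-∷ʳ (x∉xs ∷ xs!) =
  Unique.++⁺ xs! ([] ∷ []) λ { (x∈xs , here refl) → All.lookup x∉xs x∈xs refl }

other-colour : {a b c : Bool} → a ≢ b → c ≢ a → c ≡ b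
other-colour a≢b c≢a = trans (¬-not c≢a) (sym (¬-not (≢-sym a≢b)))

module Colouring {A : Set} (c : A → Bool) where

  #[_] : Bool → List A → ℕ
  #[ h ] = count (λ u → c u ≟ h)

  Alternating : List A → Set
  Alternating = Linked (λ u v → c u ≢ c v)

  #-here : ∀ {h x xs} → c x ≡ h → #[ h ] (x ∷ xs) ≡ suc (#[ h ] xs)
  #-here {h} = count-accept (λ u → c u ≟ h)

  #-there : ∀ {h x xs} → c x ≢ h → #[ h ] (x ∷ xs) ≡ #[ h ] xs
  #-there {h} = count-reject (λ u → c u ≟ h)

  open ≡-Reasoning

  mutual
    #-same-ends : ∀ {h h′ a} → h ≢ h′ → ∀ L → Alternating (a ∷ L) →
                  c a ≡ h → c (lastOf a L) ≡ h → #[ h ] (a ∷ L) ≡ suc (#[ h′ ] (a ∷ L))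
    #-same-ends h≢h′ [] _ ca _ = begin
      #[ _ ] (_ ∷ [])       ≡⟨ #-here ca ⟩
      1                     ≡⟨ cong suc (sym (#-there (h≢h′ ∘ trans (sym ca)))) ⟩
      suc (#[ _ ] (_ ∷ [])) ∎
    #-same-ends {h} {h′} {a} h≢h′ (a′ ∷ L) (a≢a′ ∷ alt) ca cl = begin
      #[ h ] (a ∷ a′ ∷ L)        ≡⟨ #-here ca ⟩
      suc (#[ h ] (a′ ∷ L))      ≡⟨ cong suc (sym (#-opposite-ends (≢-sym h≢h′) L alt ca′ cl)) ⟩
      suc (#[ h′ ] (a′ ∷ L))     ≡⟨ cong suc (sym (#-there (h≢h′ ∘ trans (sym ca)))) ⟩
      suc (#[ h′ ] (a ∷ a′ ∷ L)) ∎
      where ca′ = other-colour h≢h′ (a≢a′ ∘ trans ca ∘ sym)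

    #-opposite-ends : ∀ {h h′ a} → h ≢ h′ → ∀ L → Alternating (a ∷ L) →
                      c a ≡ h → c (lastOf a L) ≡ h′ → #[ h ] (a ∷ L) ≡ #[ h′ ] (a ∷ L)
    #-opposite-ends h≢h′ [] _ ca cl = ⊥-elim (h≢h′ (trans (sym ca) cl))
    #-opposite-ends {h} {h′} {a} h≢h′ (a′ ∷ L) (a≢a′ ∷ alt) ca cl = begin
      #[ h ] (a ∷ a′ ∷ L)   ≡⟨ #-here ca ⟩
      suc (#[ h ] (a′ ∷ L)) ≡⟨ sym (#-same-ends (≢-sym h≢h′) L alt ca′ cl) ⟩
      #[ h′ ] (a′ ∷ L)      ≡⟨ sym (#-there (h≢h′ ∘ trans (sym ca))) ⟩
      #[ h′ ] (a ∷ a′ ∷ L)  ∎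
      where ca′ = other-colour h≢h′ (a≢a′ ∘ trans ca ∘ sym)

  #-alternating-≤ : ∀ {h h′} → h ≢ h′ → ∀ L → Alternating L → #[ h ] L ≤ suc (#[ h′ ] L)
  #-alternating-≤ h≢h′ [] _ = z≤n
  #-alternating-≤ {h} {h′} h≢h′ (a ∷ L) alt = by-end-colours (c a ≟ h) (c (lastOf a L) ≟ h)
    where
    by-end-colours : Dec (c a ≡ h) → Dec (c (lastOf a L) ≡ h) → #[ h ] (a ∷ L) ≤ suc (#[ h′ ] (a ∷ L))
    by-end-colours (yes ca) (yes cl) = ≤-reflexive (#-same-ends h≢h′ L alt ca cl)
    by-end-colours (yes ca) (no cl)  =
      m≤n⇒m≤1+n (≤-reflexive (#-opposite-ends h≢h′ L alt ca (other-colour h≢h′ cl)))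
    by-end-colours (no ca)  (yes cl) =
      m≤n⇒m≤1+n (≤-reflexive (sym (#-opposite-ends (≢-sym h≢h′) L alt (other-colour h≢h′ ca) cl)))
    by-end-colours (no ca)  (no cl)  = m≤n⇒m≤1+n (≤-trans (n≤1+n _) (≤-reflexive (sym
      (#-same-ends (≢-sym h≢h′) L alt (other-colour h≢h′ ca) (other-colour h≢h′ cl)))))

module GraphFacts {n} (G : Graph n) where

  edge-sym : ∀ {u v} → Edge G u v → Edge G v u
  edge-sym {u} {v} = subst T (Graph.sym G u v)

  edge-irrefl : ∀ {v} → ¬ Edge G v v
  edge-irrefl {v} = subst T (irref G v)

  edge⇒≢ : ∀ {u v} → Edge G u v → u ≢ v
  edge⇒≢ uv refl = edge-irrefl uv

  edge? : ∀ u v → Dec (Edge G u v)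
  edge? u v = T? (adj G u v)

  walk⇒neighbour : ∀ {u v} → Walk G u v → u ≢ v → ∃ (Edge G u)
  walk⇒neighbour here       u≢u = ⊥-elim (u≢u refl)
  walk⇒neighbour (step e _) _   = _ , e

  deg : Fin n → ℕ
  deg v = count (edge? v) (allFin n)

  deg-< : ∀ {u v y} → Edge G u ⊆ Edge G v → Edge G v y → ¬ Edge G u y → deg u < deg v
  deg-< N[u]⊆N[v] vy ¬uy = count-mono-< (edge? _) (edge? _) N[u]⊆N[v] (∈-allFin _) vy ¬uy

maximum-degree-vertex : ∀ {m} (G : Graph (suc m)) →
                        ∃ λ x → ∀ u → GraphFacts.deg G u ≤ GraphFacts.deg G x
maximum-degree-vertex G = argmax deg 0F (allFin _) ,
  λ u → All.lookup (f[xs]≤f[argmax] {f = deg} 0F (allFin _)) (∈-allFin u)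
  where open GraphFacts G

module Bipartite {n} (G : Graph n) (c : Fin n → Bool) (proper : ∀ u v → Edge G u v → c u ≢ c v) where
  open GraphFacts G

  same-colour⇒¬edge : ∀ {u v} → c u ≡ c v → ¬ Edge G u v
  same-colour⇒¬edge cu≡cv uv = proper _ _ uv cu≡cv

  edge-edge⇒same-colour : ∀ {u v w} → Edge G u v → Edge G v w → c u ≡ c w
  edge-edge⇒same-colour uv vw = sym (other-colour (≢-sym (proper _ _ uv)) (≢-sym (proper _ _ vw)))

  -- Bipartiteness rules out every other chord of the walk and forces its vertices apart.
  induced-P5 : ∀ {v₀ v₁ v₂ v₃ v₄} →
               Edge G v₀ v₁ → Edge G v₁ v₂ → Edge G v₂ v₃ → Edge G v₃ v₄ →
               ¬ Edge G v₀ v₃ → ¬ Edge G v₁ v₄ → InducedP5 G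
  induced-P5 {v₀} {v₁} {v₂} {v₃} {v₄} e01 e12 e23 e34 n03 n14 = record
    { f   = f
    ; inj = λ {i} {j} → Vec.lookup-injective distinct i j
    ; fwd = fwd
    ; bwd = bwd
    }
    where
    vertices : Vec (Fin n) 5
    vertices = v₀ ∷ v₁ ∷ v₂ ∷ v₃ ∷ v₄ ∷ []
    f : Fin 5 → Fin n
    f = lookup vertices

    c02 : c v₀ ≡ c v₂
    c02 = edge-edge⇒same-colour e01 e12
    c13 : c v₁ ≡ c v₃
    c13 = edge-edge⇒same-colour e12 e23
    c24 : c v₂ ≡ c v₄
    c24 = edge-edge⇒same-colour e23 e34
    n02 : ¬ Edge G v₀ v₂
    n02 = same-colour⇒¬edge c02
    n04 : ¬ Edge G v₀ v₄
    n04 = same-colour⇒¬edge (trans c02 c24)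
    n13 : ¬ Edge G v₁ v₃
    n13 = same-colour⇒¬edge c13
    n24 : ¬ Edge G v₂ v₄
    n24 = same-colour⇒¬edge c24

    distinct : UniqueVec vertices
    distinct =
        (edge⇒≢ e01 ∷ (λ { refl → n03 e23 }) ∷ (λ eq → proper _ _ e23 (trans (sym c02) (cong c eq)))
                    ∷ (λ { refl → n03 (edge-sym e34) }) ∷ [])
      ∷ (edge⇒≢ e12 ∷ (λ { refl → n14 e34 }) ∷ (λ eq → proper _ _ e34 (trans (sym c13) (cong c eq))) ∷ [])
      ∷ (edge⇒≢ e23 ∷ (λ { refl → n14 e12 }) ∷ [])
      ∷ (edge⇒≢ e34 ∷ [])
      ∷ [] ∷ []

    fwd : ∀ i j → Edge G (f i) (f j) → PathAdj i j
    fwd 0F 0F = ⊥-elim ∘ edge-irrefl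
    fwd 0F 1F = λ _ → inj₁ refl
    fwd 0F 2F = ⊥-elim ∘ n02
    fwd 0F 3F = ⊥-elim ∘ n03
    fwd 0F 4F = ⊥-elim ∘ n04
    fwd 1F 0F = λ _ → inj₂ refl
    fwd 1F 1F = ⊥-elim ∘ edge-irrefl
    fwd 1F 2F = λ _ → inj₁ refl
    fwd 1F 3F = ⊥-elim ∘ n13
    fwd 1F 4F = ⊥-elim ∘ n14
    fwd 2F 0F = ⊥-elim ∘ n02 ∘ edge-sym
    fwd 2F 1F = λ _ → inj₂ refl
    fwd 2F 2F = ⊥-elim ∘ edge-irrefl
    fwd 2F 3F = λ _ → inj₁ refl
    fwd 2F 4F = ⊥-elim ∘ n24
    fwd 3F 0F = ⊥-elim ∘ n03 ∘ edge-sym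
    fwd 3F 1F = ⊥-elim ∘ n13 ∘ edge-sym
    fwd 3F 2F = λ _ → inj₂ refl
    fwd 3F 3F = ⊥-elim ∘ edge-irrefl
    fwd 3F 4F = λ _ → inj₁ refl
    fwd 4F 0F = ⊥-elim ∘ n04 ∘ edge-sym
    fwd 4F 1F = ⊥-elim ∘ n14 ∘ edge-sym
    fwd 4F 2F = ⊥-elim ∘ n24 ∘ edge-sym
    fwd 4F 3F = λ _ → inj₂ refl
    fwd 4F 4F = ⊥-elim ∘ edge-irrefl

    next : ∀ i j → suc (toℕ i) ≡ toℕ j → Edge G (f i) (f j)
    next 0F 1F _ = e01
    next 1F 2F _ = e12
    next 2F 3F _ = e23
    next 3F 4F _ = e34
    next 0F 0F ()
    next 0F (Fin.suc (Fin.suc _)) ()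
    next 1F 0F ()
    next 1F 1F ()
    next 1F (Fin.suc (Fin.suc (Fin.suc _))) ()
    next 2F 0F ()
    next 2F 1F ()
    next 2F 2F ()
    next 2F 4F ()
    next 3F 0F ()
    next 3F 1F ()
    next 3F 2F ()
    next 3F 3F ()
    next 4F 0F ()
    next 4F 1F ()
    next 4F 2F ()
    next 4F 3F ()
    next 4F 4F ()

    bwd : ∀ i j → PathAdj i j → Edge G (f i) (f j)
    bwd i j (inj₁ i→j) = next i j i→j
    bwd i j (inj₂ j→i) = edge-sym (next j i j→i)

  module MaximumDegree (p5-free : P5Free G) {x} (x-max : ∀ u → deg u ≤ deg x) where

    N[x]⊈N[v] : ∀ {v y} → Edge G v y → ¬ Edge G x y → ∃ λ z → Edge G x z × ¬ Edge G v z
    N[x]⊈N[v] {v} vy ¬xy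
      with ¬∀⟶∃¬ n (λ z → Edge G x z → Edge G v z) (λ z → edge? x z →-dec edge? v z)
                 (λ N[x]⊆N[v] → <⇒≱ (deg-< (N[x]⊆N[v] _) vy ¬xy) (x-max v))
    ... | z , ¬x⇒v = z , decidable-stable (edge? x z) (λ ¬xz → ¬x⇒v (⊥-elim ∘ ¬xz)) , λ vz → ¬x⇒v (λ _ → vz)

    max-degree-closes-P4 : ∀ {y z w} → Edge G x y → Edge G y z → Edge G z w → Edge G x w
    max-degree-closes-P4 xy yz zw = decidable-stable (edge? x _) λ ¬xw →
      let (u , xu , ¬zu) = N[x]⊈N[v] zw ¬xw
      in p5-free (induced-P5 (edge-sym xu) xy yz zw (¬zu ∘ edge-sym) ¬xw)

    Distance≤2 : Fin n → Set
    Distance≤2 t = x ≡ t ⊎ Edge G x t ⊎ ∃ λ y → Edge G x y × Edge G y t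

    distance≤2-step : ∀ {t w} → Distance≤2 t → Edge G t w → Distance≤2 w
    distance≤2-step (inj₁ refl)                 tw = inj₂ (inj₁ tw)
    distance≤2-step (inj₂ (inj₁ xt))            tw = inj₂ (inj₂ (_ , xt , tw))
    distance≤2-step (inj₂ (inj₂ (_ , xy , yt))) tw = inj₂ (inj₁ (max-degree-closes-P4 xy yt tw))

    distance≤2-walk : ∀ {u t} → Distance≤2 u → Walk G u t → Distance≤2 t
    distance≤2-walk d here       = d
    distance≤2-walk d (step e w) = distance≤2-walk (distance≤2-step d e) w

    max-adjacent-to-other-side : Connected G → ∀ t → c t ≢ c x → Edge G x t
    max-adjacent-to-other-side conn t ct≢cx with distance≤2-walk (inj₁ refl) (conn x t)
    ... | inj₁ refl                 = ⊥-elim (ct≢cx refl)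
    ... | inj₂ (inj₁ xt)            = xt
    ... | inj₂ (inj₂ (_ , xy , yt)) = ⊥-elim (ct≢cx (sym (edge-edge⇒same-colour xy yt)))

record HamPathAvoiding {n} (G : Graph n) (v : Fin n) : Set where
  field
    vertices : List (Fin n)
    distinct : Unique (v ∷ vertices)
    covers   : ∀ u → u ∈ v ∷ vertices
    linked   : Linked (Edge G) vertices

hamPath-delete⇒avoiding : ∀ {n} {G : Graph (suc n)} {v} → HamPath (delete G v) → HamPathAvoiding G v
hamPath-delete⇒avoiding {v = v} P = record
  { vertices = map (punchIn v) vertices
  ; distinct = All.map⁺ (All.universal (λ i → punchInᵢ≢i v i ∘ sym) vertices)
             ∷ Unique.map⁺ (punchIn-injective v _ _) distinct
  ; covers   = covers′
  ; linked   = Linked.map⁺ linked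
  }
  where
  open HamPath P
  covers′ : ∀ u → u ∈ v ∷ map (punchIn v) vertices
  covers′ u with v Fin.≟ u
  ... | yes refl = here refl
  ... | no v≢u   = there (subst (_∈ map (punchIn v) vertices) (punchIn-punchOut v≢u)
                                (∈-map⁺ (punchIn v) (covers (Fin.punchOut v≢u))))

module Counting {n} (G : Graph n) (c : Fin n → Bool) (proper : ∀ u v → Edge G u v → c u ≢ c v) where
  open GraphFacts G
  open Colouring c

  class-size : Bool → ℕ
  class-size h = #[ h ] (allFin n)

  #-spanning : ∀ {h v L} → Unique (v ∷ L) → (∀ u → u ∈ v ∷ L) → #[ h ] (v ∷ L) ≡ class-size h
  #-spanning {h} v∷L! covers =
    count-↭ (λ u → c u ≟ h) (unique∧covering⇒↭ v∷L! (Unique.allFin⁺ n) covers ∈-allFin)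

  path-alternating : ∀ {L} → Linked (Edge G) L → Alternating L
  path-alternating = Linked.map (proper _ _)

  avoiding-bound : ∀ {h y} → c y ≢ h → HamPathAvoiding G y → class-size h ≤ class-size (c y)
  avoiding-bound {h} {y} cy≢h P = begin
    class-size h            ≡⟨ sym (#-spanning distinct covers) ⟩
    #[ h ] (y ∷ vertices)   ≡⟨ #-there cy≢h ⟩
    #[ h ] vertices         ≤⟨ #-alternating-≤ (≢-sym cy≢h) vertices (path-alternating linked) ⟩
    suc (#[ c y ] vertices) ≡⟨ sym (#-here refl) ⟩
    #[ c y ] (y ∷ vertices) ≡⟨ #-spanning distinct covers ⟩
    class-size (c y)        ∎
    where
    open HamPathAvoiding P
    open ≤-Reasoning

  module _ (no-hamPath : ¬ HamPath G) {x} (x-adjacent : ∀ t → c t ≢ c x → Edge G x t) where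

    avoiding-ends : ∀ {a L} → Unique (x ∷ a ∷ L) → (∀ u → u ∈ x ∷ a ∷ L) →
                    Linked (Edge G) (a ∷ L) → c a ≡ c x × c (lastOf a L) ≡ c x
    avoiding-ends {a} {L} x∷a∷L! covers lk with c a ≟ c x | c (lastOf a L) ≟ c x
    ... | no ca≢cx | _ = ⊥-elim (no-hamPath record
      { vertices = x ∷ a ∷ L ; distinct = x∷a∷L! ; covers = covers ; linked = x-adjacent a ca≢cx ∷ lk })
    ... | yes _ | no cl≢cx = ⊥-elim (no-hamPath record
      { vertices = a ∷ L ∷ʳ x
      ; distinct = Unique-∷ʳ x∷a∷L!
      ; covers   = λ u → ∈-resp-↭ (∷↭∷ʳ x (a ∷ L)) (covers u)
      ; linked   = Linked-∷ʳ L lk (edge-sym (x-adjacent _ cl≢cx)) })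
    ... | yes ca | yes cl = ca , cl

    avoiding-surplus : ∀ {h a L} → c x ≢ h → Unique (x ∷ a ∷ L) → (∀ u → u ∈ x ∷ a ∷ L) →
                       Linked (Edge G) (a ∷ L) → class-size (c x) ≡ 2 + class-size h
    avoiding-surplus {h} {a} {L} cx≢h x∷a∷L! covers lk = begin
      class-size (c x)       ≡⟨ sym (#-spanning x∷a∷L! covers) ⟩
      #[ c x ] (x ∷ a ∷ L)   ≡⟨ #-here refl ⟩
      suc (#[ c x ] (a ∷ L)) ≡⟨ cong suc (#-same-ends cx≢h L (path-alternating lk) ca cl) ⟩
      2 + #[ h ] (a ∷ L)     ≡⟨ cong (2 +_) (sym (#-there cx≢h)) ⟩
      2 + #[ h ] (x ∷ a ∷ L) ≡⟨ cong (2 +_) (#-spanning x∷a∷L! covers) ⟩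
      2 + class-size h       ∎
      where
      open ≡-Reasoning
      ends : c a ≡ c x × c (lastOf a L) ≡ c x
      ends = avoiding-ends x∷a∷L! covers lk
      ca : c a ≡ c x
      ca = proj₁ ends
      cl : c (lastOf a L) ≡ c x
      cl = proj₂ ends

    no-avoiding-paths : Connected G → (∀ v → HamPathAvoiding G v) → ⊥
    no-avoiding-paths conn avoiding with avoiding x
    ... | record { vertices = [] ; distinct = x! ; covers = covers } =
      no-hamPath record { vertices = x ∷ [] ; distinct = x! ; covers = covers ; linked = [-] }
    ... | record { vertices = a ∷ L ; distinct = x∷a∷L! ; covers = covers ; linked = lk } =
      m+n≮n 1 (class-size (c y)) (subst (_≤ class-size (c y)) surplus bound)
      where
      x≢a : x ≢ a
      x≢a = All.head (AllPairs.head x∷a∷L!)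
      y : Fin n
      y = proj₁ (walk⇒neighbour (conn x a) x≢a)
      xy : Edge G x y
      xy = proj₂ (walk⇒neighbour (conn x a) x≢a)
      surplus : class-size (c x) ≡ 2 + class-size (c y)
      surplus = avoiding-surplus (proper x y xy) x∷a∷L! covers lk
      bound : class-size (c x) ≤ class-size (c y)
      bound = avoiding-bound (≢-sym (proper x y xy)) (avoiding y)

theorem11 : ∀ {n : ℕ} (G : Graph n) → Connected G → P5Free G → ChordalBipartite G → ¬ HasHamPath G → ¬ PathHypohamiltonian G
theorem11 {zero} G _ _ _ no-hamPath _ =
  no-hamPath record { vertices = [] ; distinct = [] ; covers = λ () ; linked = [] }
theorem11 {suc m} G conn p5-free ((c , proper) , _) no-hamPath (_ , hypo) =
  Counting.no-avoiding-paths G c proper no-hamPath x-adjacent conn avoiding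
  where
  open GraphFacts G using (deg)
  x : Fin (suc m)
  x = proj₁ (maximum-degree-vertex G)
  x-max : ∀ u → deg u ≤ deg x
  x-max = proj₂ (maximum-degree-vertex G)
  x-adjacent : ∀ t → c t ≢ c x → Edge G x t
  x-adjacent = Bipartite.MaximumDegree.max-adjacent-to-other-side G c proper p5-free x-max conn

  avoiding : ∀ v → HamPathAvoiding G v
  avoiding v = hamPath-delete⇒avoiding (hypo v)
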